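{- Let $n\in\mathbb{Z}_{>0}$, $d\in\mathbb{Q}_{>0}$, and let $p:\mathbb{Q}\to\mathbb{Q}$ be of the form \[p(r)=p_nr^n+p_{n-1}(r)r^{n-1}+\dots+p_1(r)r+p_0(r),\] where $0\neq p_n\in\mathbb{Q}$ is a constant and $p_i:\mathbb{Q}\to\mathbb{Q}$, $i=0,\dots,n-1$, are periodic with period $d$. Suppose there exist an interval $(r_1,r_2)$ and numbers $c_k\in\mathbb{Q}$, $k\in\mathbb{Z}_{\geq 0}$, such that \[p(r+kd)=c_k\quad\text{for all rational } r\in (r_1,r_2)\text{ and all } k\in\mathbb{Z}_{\geq 0}.\] Then for each $i=0,\dots,n-1$, the restriction of $p_i$ to the rationals in $(r_1,r_2)$ is a polynomial of degree $n-i$. Furthermore, if $p_n>0$ then $p_{n-1}$ (on $(r_1,r_2)$) has negative leading coefficient. -}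

module Defs where

open import Data.Nat using (ℕ; zero; suc; _∸_)
open import Data.Integer using (+_)
open import Data.Fin using (Fin; toℕ)
open import Data.Vec using (Vec; []; _∷_; last)
open import Data.Rational using (ℚ; 0ℚ; 1ℚ; _+_; _*_; _/_; _<_)
open import Relation.Binary.PropositionalEquality using (_≡_)

_^ℚ_ : ℚ → ℕ → ℚ
r ^ℚ zero  = 1ℚ
r ^ℚ suc k = r * (r ^ℚ k)

ℕ→ℚ : ℕ → ℚ
ℕ→ℚ k = + k / 1

sumFin : (n : ℕ) → (Fin n → ℚ) → ℚ
sumFin zero    f = 0ℚ
sumFin (suc n) f = f Fin.zero + sumFin n (λ i → f (Fin.suc i))

-- evaluate a polynomial with coefficient vector (a₀, a₁, …, a_m)  (low degree first)
evalPoly : {m : ℕ} → Vec ℚ m → ℚ → ℚ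
evalPoly []       x = 0ℚ
evalPoly (a ∷ as) x = a + x * evalPoly as x

pFun : (n : ℕ) → ℚ → (Fin n → ℚ → ℚ) → ℚ → ℚ
pFun n pn ps r = pn * (r ^ℚ n) + sumFin n (λ i → ps i r * (r ^ℚ toℕ i))

Periodic : ℚ → (ℚ → ℚ) → Set
Periodic d f = ∀ r → f (r + d) ≡ f r

InOpen : ℚ → ℚ → ℚ → Set
InOpen r₁ r₂ r = (r₁ < r) Data.Product.× (r < r₂)
  where import Data.Product

PolyOfDegreeOn : ℚ → ℚ → (m : ℕ) → (ℚ → ℚ) → Vec ℚ (suc m) → Set
PolyOfDegreeOn r₁ r₂ m f a =
  (last a ≡ 0ℚ → Data.Empty.⊥) Data.Product.×
  (∀ r → InOpen r₁ r₂ r → f r ≡ evalPoly a r)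
  where import Data.Product
        import Data.Empty

-- Freezing the periodic coefficients at r turns p into an honest polynomial Pᵣ of
-- degree n, and periodicity gives Pᵣ(r + kd) = p(r + kd) = cₖ.  Fix r₀ in the interval
-- and let B(y) = Pᵣ₀(r₀ + y), so that B(kd) = cₖ.  For every r in the interval the
-- polynomials Pᵣ(x) and B(x − r) agree at the infinitely many points r + kd, hence
-- have the same coefficients.  Expanding B(x − r) by the binomial theorem shows that
-- the coefficient of xⁱ, which is pᵢ(r), is a polynomial in r of degree n − i with
-- leading coefficient (−1)ⁿ⁻ⁱ (n choose i) pₙ.
module Submission where

open import Defs
open import Data.Nat as ℕ using (ℕ; zero; suc; _∸_; NonZero; s≤s)
import Data.Nat.Properties as ℕP
open import Data.Nat.Combinatorics using (_C_; nCn≡1; k>n⇒nCk≡0; nCk+nC[k+1]≡[n+1]C[k+1])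
open import Data.Fin as Fin using (Fin; toℕ)
import Data.Fin.Properties as FinP
open import Data.Vec using (Vec; []; _∷_; last)
open import Data.Product using (Σ; _×_; _,_; proj₂)
open import Data.Integer as ℤ using ()
import Data.Integer.Properties as ℤP
open import Data.Rational
  using (ℚ; 0ℚ; 1ℚ; _+_; _*_; _-_; -_; 1/_; _<_; Positive; ≢-nonZero; toℚᵘ)
import Data.Rational.Properties as ℚP
import Data.Rational.Unnormalised as ℚᵘ
import Data.Rational.Unnormalised.Properties as ℚᵘP
open import Data.Rational.Solver using (module +-*-Solver)
open import Algebra.Properties.Group ℚP.+-0-group using () renaming (x∙y⁻¹≈ε⇒x≈y to p-q≡0⇒p≡q)
open import Function using (_∘_)
open import Function.Definitions using (Injective)
open import Relation.Binary.PropositionalEquality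
open +-*-Solver

-- ℕ→ℚ k is fromℚᵘ (k / 1) by definition, so sums are compared in ℚᵘ, where nothing is normalised.
ℕ→ℚ-+ : ∀ a b → ℕ→ℚ (a ℕ.+ b) ≡ ℕ→ℚ a + ℕ→ℚ b
ℕ→ℚ-+ a b = ℚP.toℚᵘ-injective (begin
  toℚᵘ (ℕ→ℚ (a ℕ.+ b))            ≈⟨ ℚP.toℚᵘ-fromℚᵘ ⌜ a ℕ.+ b ⌝ ⟩
  ⌜ a ℕ.+ b ⌝                      ≈⟨ ℚᵘ.*≡* (cong (ℤ._* ℤ.+ 1) (cong₂ ℤ._+_ (ℤP.*-identityʳ (ℤ.+ a)) (ℤP.*-identityʳ (ℤ.+ b)))) ⟨
  ⌜ a ⌝ ℚᵘ.+ ⌜ b ⌝                 ≈⟨ ℚᵘP.+-cong (ℚP.toℚᵘ-fromℚᵘ ⌜ a ⌝) (ℚP.toℚᵘ-fromℚᵘ ⌜ b ⌝) ⟨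
  toℚᵘ (ℕ→ℚ a) ℚᵘ.+ toℚᵘ (ℕ→ℚ b)   ≈⟨ ℚP.toℚᵘ-homo-+ (ℕ→ℚ a) (ℕ→ℚ b) ⟨
  toℚᵘ (ℕ→ℚ a + ℕ→ℚ b)            ∎)
  where
    open ℚᵘP.≃-Reasoning
    ⌜_⌝ : ℕ → ℚᵘ.ℚᵘ
    ⌜ k ⌝ = ℚᵘ.mkℚᵘ (ℤ.+ k) 0

open ≡-Reasoning

p≡q⇒p-q≡0 : ∀ {p q} → p ≡ q → p - q ≡ 0ℚ
p≡q⇒p-q≡0 {q = q} refl = ℚP.+-inverseʳ q

pos⇒≢0 : ∀ {p} → Positive p → p ≢ 0ℚ
pos⇒≢0 {p} p>0 p≡0 = ℚP.<-irrefl (sym p≡0) (ℚP.positive⁻¹ p {{p>0}})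

*-cancelˡ-≡0 : ∀ {p q} → p ≢ 0ℚ → p * q ≡ 0ℚ → q ≡ 0ℚ
*-cancelˡ-≡0 {p} {q} p≢0 pq≡0 = begin
  q                ≡⟨ ℚP.*-identityˡ q ⟨
  1ℚ * q           ≡⟨ cong (_* q) (ℚP.*-inverseˡ p) ⟨
  (1/ p * p) * q   ≡⟨ ℚP.*-assoc (1/ p) p q ⟩
  1/ p * (p * q)   ≡⟨ cong (1/ p *_) pq≡0 ⟩
  1/ p * 0ℚ        ≡⟨ ℚP.*-zeroʳ (1/ p) ⟩
  0ℚ               ∎
  where instance _ = ≢-nonZero p≢0

-1≢0 : - 1ℚ ≢ 0ℚ
-1≢0 = ℚP.1≢0 ∘ ℚP.neg-injective

*-≢0 : ∀ {p q} → p ≢ 0ℚ → q ≢ 0ℚ → p * q ≢ 0ℚ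
*-≢0 p≢0 q≢0 pq≡0 = q≢0 (*-cancelˡ-≡0 p≢0 pq≡0)

^ℚ-≢0 : ∀ {p} → p ≢ 0ℚ → ∀ k → p ^ℚ k ≢ 0ℚ
^ℚ-≢0 p≢0 zero    = ℚP.1≢0
^ℚ-≢0 p≢0 (suc k) = *-≢0 p≢0 (^ℚ-≢0 p≢0 k)

ℕ→ℚ-injective : Injective _≡_ _≡_ ℕ→ℚ
ℕ→ℚ-injective {i} {j} eq with ℚP.fromℚᵘ-injective {ℚᵘ.mkℚᵘ (ℤ.+ i) 0} {ℚᵘ.mkℚᵘ (ℤ.+ j) 0} eq
... | ℚᵘ.*≡* e = ℤP.+-injective (begin
  ℤ.+ i          ≡⟨ ℤP.*-identityʳ (ℤ.+ i) ⟨
  ℤ.+ i ℤ.* ℤ.+ 1 ≡⟨ e ⟩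
  ℤ.+ j ℤ.* ℤ.+ 1 ≡⟨ ℤP.*-identityʳ (ℤ.+ j) ⟩
  ℤ.+ j          ∎)

ℕ→ℚ-pos : ∀ {k} → 0 ℕ.< k → Positive (ℕ→ℚ k)
ℕ→ℚ-pos {suc k} _ = ℚP.normalize-pos (suc k) 1

k≤n⇒0<nCk : ∀ {n k} → k ℕ.≤ n → 0 ℕ.< n C k
k≤n⇒0<nCk {n}     {zero}  _         = ℕ.z<s
k≤n⇒0<nCk {suc n} {suc k} (s≤s k≤n) = subst (0 ℕ.<_) (nCk+nC[k+1]≡[n+1]C[k+1] n k)
  (ℕP.<-≤-trans (k≤n⇒0<nCk k≤n) (ℕP.m≤m+n (n C k) (n C suc k)))

binom : ℕ → ℕ → ℚ
binom n k = ℕ→ℚ (n C k)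

binom-pos : ∀ {n k} → k ℕ.≤ n → Positive (binom n k)
binom-pos k≤n = ℕ→ℚ-pos (k≤n⇒0<nCk k≤n)

binom-pascal : ∀ n k → binom (suc n) (suc k) ≡ binom n k + binom n (suc k)
binom-pascal n k = trans (cong ℕ→ℚ (sym (nCk+nC[k+1]≡[n+1]C[k+1] n k))) (ℕ→ℚ-+ (n C k) (n C suc k))

-- Polynomials as coefficient sequences of a given length

tail : (ℕ → ℚ) → ℕ → ℚ
tail a t = a (suc t)

horner : ℕ → (ℕ → ℚ) → ℚ → ℚ
horner zero    a x = 0ℚ
horner (suc m) a x = a 0 + x * horner m (tail a) x

horner-cong : ∀ m {a b} → (∀ t → a t ≡ b t) → ∀ x → horner m a x ≡ horner m b x
horner-cong zero    a≗b x = refl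
horner-cong (suc m) a≗b x = cong₂ (λ u v → u + x * v) (a≗b 0) (horner-cong m (a≗b ∘ suc) x)

horner-+ : ∀ m a b x → horner m (λ t → a t + b t) x ≡ horner m a x + horner m b x
horner-+ zero    a b x = sym (ℚP.+-identityˡ 0ℚ)
horner-+ (suc m) a b x = begin
  (a 0 + b 0) + x * horner m (λ t → a (suc t) + b (suc t)) x
    ≡⟨ cong (λ v → (a 0 + b 0) + x * v) (horner-+ m (tail a) (tail b) x) ⟩
  (a 0 + b 0) + x * (horner m (tail a) x + horner m (tail b) x)
    ≡⟨ solve 5 (λ a b x u v → (a :+ b) :+ x :* (u :+ v) := (a :+ x :* u) :+ (b :+ x :* v))
         refl (a 0) (b 0) x (horner m (tail a) x) (horner m (tail b) x) ⟩
  horner (suc m) a x + horner (suc m) b x ∎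

horner-- : ∀ m a b x → horner m (λ t → a t - b t) x ≡ horner m a x - horner m b x
horner-- zero    a b x = refl
horner-- (suc m) a b x = begin
  (a 0 - b 0) + x * horner m (λ t → a (suc t) - b (suc t)) x
    ≡⟨ cong (λ v → (a 0 - b 0) + x * v) (horner-- m (tail a) (tail b) x) ⟩
  (a 0 - b 0) + x * (horner m (tail a) x - horner m (tail b) x)
    ≡⟨ solve 5 (λ a b x u v → (a :- b) :+ x :* (u :- v) := (a :+ x :* u) :- (b :+ x :* v))
         refl (a 0) (b 0) x (horner m (tail a) x) (horner m (tail b) x) ⟩
  horner (suc m) a x - horner (suc m) b x ∎

horner-* : ∀ m c a x → horner m (λ t → c * a t) x ≡ c * horner m a x
horner-* zero    c a x = sym (ℚP.*-zeroʳ c)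
horner-* (suc m) c a x = begin
  c * a 0 + x * horner m (λ t → c * a (suc t)) x
    ≡⟨ cong (λ v → c * a 0 + x * v) (horner-* m c (tail a) x) ⟩
  c * a 0 + x * (c * horner m (tail a) x)
    ≡⟨ solve 4 (λ c a x u → c :* a :+ x :* (c :* u) := c :* (a :+ x :* u)) refl c (a 0) x (horner m (tail a) x) ⟩
  c * horner (suc m) a x ∎

horner-trailing-0 : ∀ m a x → a m ≡ 0ℚ → horner (suc m) a x ≡ horner m a x
horner-trailing-0 zero    a x a₀≡0 = begin
  a 0 + x * 0ℚ   ≡⟨ cong (_+ x * 0ℚ) a₀≡0 ⟩
  0ℚ + x * 0ℚ    ≡⟨ solve 1 (λ x → con 0ℚ :+ x :* con 0ℚ := con 0ℚ) refl x ⟩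
  0ℚ             ∎
horner-trailing-0 (suc m) a x aₘ≡0 = cong (λ v → a 0 + x * v) (horner-trailing-0 m (tail a) x aₘ≡0)

horner-unfold : ∀ m a x → a m ≡ 0ℚ → horner m a x ≡ a 0 + x * horner m (tail a) x
horner-unfold zero    a x a₀≡0 = begin
  0ℚ             ≡⟨ solve 1 (λ x → con 0ℚ := con 0ℚ :+ x :* con 0ℚ) refl x ⟩
  0ℚ + x * 0ℚ    ≡⟨ cong (_+ x * 0ℚ) a₀≡0 ⟨
  a 0 + x * 0ℚ   ∎
horner-unfold (suc m) a x aₘ≡0 = cong (λ v → a 0 + x * v) (sym (horner-trailing-0 m (tail a) x aₘ≡0))

horner-leading-0 : ∀ m a x → a 0 ≡ 0ℚ → horner m a x ≡ x * horner (ℕ.pred m) (tail a) x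
horner-leading-0 zero    a x _    = sym (ℚP.*-zeroʳ x)
horner-leading-0 (suc m) a x a₀≡0 = begin
  a 0 + x * horner m (tail a) x   ≡⟨ cong (_+ x * horner m (tail a) x) a₀≡0 ⟩
  0ℚ + x * horner m (tail a) x    ≡⟨ ℚP.+-identityˡ _ ⟩
  x * horner m (tail a) x         ∎

horner-at-neg : ∀ m a x → horner m a (- x) ≡ horner m (λ t → a t * (- 1ℚ) ^ℚ t) x
horner-at-neg zero    a x = refl
horner-at-neg (suc m) a x = begin
  a 0 + (- x) * horner m (tail a) (- x)
    ≡⟨ cong (λ v → a 0 + (- x) * v) (horner-at-neg m (tail a) x) ⟩
  a 0 + (- x) * horner m (λ t → a (suc t) * (- 1ℚ) ^ℚ t) x
    ≡⟨ solve 3 (λ a x u → a :+ (:- x) :* u := a :* con 1ℚ :+ x :* (:- con 1ℚ :* u)) refl (a 0) x _ ⟩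
  a 0 * 1ℚ + x * (- 1ℚ * horner m (λ t → a (suc t) * (- 1ℚ) ^ℚ t) x)
    ≡⟨ cong (λ v → a 0 * 1ℚ + x * v) (sym (trans
         (horner-cong m (λ t → solve 3 (λ a c s → a :* (c :* s) := c :* (a :* s)) refl (a (suc t)) (- 1ℚ) ((- 1ℚ) ^ℚ t)) x)
         (horner-* m (- 1ℚ) (λ t → a (suc t) * (- 1ℚ) ^ℚ t) x))) ⟩
  a 0 * 1ℚ + x * horner m (λ t → a (suc t) * (- 1ℚ * (- 1ℚ) ^ℚ t)) x ∎

coeffVec : (m : ℕ) → (ℕ → ℚ) → Vec ℚ m
coeffVec zero    a = []
coeffVec (suc m) a = a 0 ∷ coeffVec m (tail a)

evalPoly-coeffVec : ∀ m a x → evalPoly (coeffVec m a) x ≡ horner m a x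
evalPoly-coeffVec zero    a x = refl
evalPoly-coeffVec (suc m) a x = cong (λ v → a 0 + x * v) (evalPoly-coeffVec m (tail a) x)

last-coeffVec : ∀ m a → last (coeffVec (suc m) a) ≡ a m
last-coeffVec zero    a = refl
last-coeffVec (suc m) a = last-coeffVec m (tail a)

-- A polynomial vanishing at infinitely many points is zero

-- Coefficients of the quotient (a(x) − a(c)) / (x − c).
quotient : ℚ → ℕ → (ℕ → ℚ) → ℕ → ℚ
quotient c zero    a t       = 0ℚ
quotient c (suc m) a zero    = horner m (tail a) c
quotient c (suc m) a (suc t) = quotient c m (tail a) t

horner-factor : ∀ m a c x →
  horner (suc m) a x ≡ horner (suc m) a c + (x - c) * horner m (quotient c (suc m) a) x
horner-factor zero    a c x =
  solve 3 (λ a x c → a :+ x :* con 0ℚ := (a :+ c :* con 0ℚ) :+ (x :- c) :* con 0ℚ) refl (a 0) x c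
horner-factor (suc m) a c x = begin
  a 0 + x * horner (suc m) (tail a) x
    ≡⟨ cong (λ v → a 0 + x * v) (horner-factor m (tail a) c x) ⟩
  a 0 + x * (E + (x - c) * D)
    ≡⟨ solve 5 (λ a x c E D → a :+ x :* (E :+ (x :- c) :* D) := (a :+ c :* E) :+ (x :- c) :* (E :+ x :* D))
         refl (a 0) x c E D ⟩
  (a 0 + c * E) + (x - c) * (E + x * D) ∎
  where
    E = horner (suc m) (tail a) c
    D = horner m (quotient c (suc m) (tail a)) x

horner-vanishes : ∀ m a {p : ℕ → ℚ} → Injective _≡_ _≡_ p →
  (∀ k → horner m a (p k) ≡ 0ℚ) → ∀ x → horner m a x ≡ 0ℚ
horner-vanishes zero    a p-inj roots x = refl
horner-vanishes (suc m) a {p} p-inj roots x = begin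
  horner (suc m) a x                         ≡⟨ horner-factor m a (p 0) x ⟩
  horner (suc m) a (p 0) + (x - p 0) * q x   ≡⟨ cong₂ (λ u v → u + (x - p 0) * v) (roots 0) (q-vanishes x) ⟩
  0ℚ + (x - p 0) * 0ℚ                        ≡⟨ solve 1 (λ y → con 0ℚ :+ y :* con 0ℚ := con 0ℚ) refl (x - p 0) ⟩
  0ℚ                                         ∎
  where
    q : ℚ → ℚ
    q = horner m (quotient (p 0) (suc m) a)
    q-roots : ∀ k → q (p (suc k)) ≡ 0ℚ
    q-roots k = *-cancelˡ-≡0 (λ e → ℕP.1+n≢0 (p-inj (p-q≡0⇒p≡q _ _ e))) (begin
      (y - p 0) * q y                            ≡⟨ ℚP.+-identityˡ _ ⟨
      0ℚ + (y - p 0) * q y                       ≡⟨ cong (_+ (y - p 0) * q y) (roots 0) ⟨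
      horner (suc m) a (p 0) + (y - p 0) * q y   ≡⟨ horner-factor m a (p 0) y ⟨
      horner (suc m) a y                         ≡⟨ roots (suc k) ⟩
      0ℚ                                         ∎)
      where y = p (suc k)
    q-vanishes : ∀ x → q x ≡ 0ℚ
    q-vanishes = horner-vanishes m _ (ℕP.suc-injective ∘ p-inj) q-roots

horner≡0⇒coeff≡0 : ∀ m a → (∀ x → horner m a x ≡ 0ℚ) → ∀ {j} → j ℕ.< m → a j ≡ 0ℚ
horner≡0⇒coeff≡0 (suc m) a vanishes {zero} _ = begin
  a 0                 ≡⟨ solve 2 (λ a h → a := a :+ con 0ℚ :* h) refl (a 0) (horner m (tail a) 0ℚ) ⟩
  horner (suc m) a 0ℚ ≡⟨ vanishes 0ℚ ⟩
  0ℚ                  ∎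
horner≡0⇒coeff≡0 (suc m) a vanishes {suc j} (s≤s j<m) =
  horner≡0⇒coeff≡0 m (tail a) (horner-vanishes m (tail a) (ℕP.suc-injective ∘ ℕ→ℚ-injective) tail-roots) j<m
  where
    -- x · (tail a)(x) = a(x) − a₀ vanishes, so (tail a) vanishes at every nonzero x, e.g. at 1, 2, 3, …
    tail-roots : ∀ k → horner m (tail a) (ℕ→ℚ (suc k)) ≡ 0ℚ
    tail-roots k = *-cancelˡ-≡0 {x} (pos⇒≢0 (ℕ→ℚ-pos {suc k} ℕ.z<s)) (begin
      x * horner m (tail a) x         ≡⟨ ℚP.+-identityˡ _ ⟨
      0ℚ + x * horner m (tail a) x    ≡⟨ cong (_+ x * horner m (tail a) x) (horner≡0⇒coeff≡0 (suc m) a vanishes ℕ.z<s) ⟨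
      horner (suc m) a x              ≡⟨ vanishes x ⟩
      0ℚ                              ∎)
      where x = ℕ→ℚ (suc k)

horner-agree⇒coeff-agree : ∀ m a b {p : ℕ → ℚ} → Injective _≡_ _≡_ p →
  (∀ k → horner m a (p k) ≡ horner m b (p k)) → ∀ {j} → j ℕ.< m → a j ≡ b j
horner-agree⇒coeff-agree m a b p-inj agree j<m = p-q≡0⇒p≡q _ _
  (horner≡0⇒coeff≡0 m (λ t → a t - b t)
    (horner-vanishes m _ p-inj (λ k → trans (horner-- m a b _) (p≡q⇒p-q≡0 (agree k)))) j<m)

-- Taylor shift: coefficients of y ↦ Q(s + y)

taylorShift : ℕ → (ℕ → ℚ) → ℚ → ℕ → ℚ
taylorShift m Q s i = horner (m ∸ i) (λ t → Q (i ℕ.+ t) * binom (i ℕ.+ t) i) s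

-- (t choose 0) computes to 1, so the binomial weights disappear.
taylorShift-zero : ∀ m Q s → taylorShift (suc m) Q s 0 ≡ Q 0 + s * taylorShift m (tail Q) s 0
taylorShift-zero m Q s = cong (_+ s * taylorShift m (tail Q) s 0) (ℚP.*-identityʳ (Q 0))

taylorShift-suc : ∀ m Q s i →
  taylorShift (suc m) Q s (suc i) ≡ taylorShift m (tail Q) s i + s * taylorShift m (tail Q) s (suc i)
taylorShift-suc m Q s i = begin
  horner (m ∸ i) (λ t → Q' (i ℕ.+ t) * binom (suc (i ℕ.+ t)) (suc i)) s
    ≡⟨ horner-cong (m ∸ i) (λ t → trans (cong (Q' (i ℕ.+ t) *_) (binom-pascal (i ℕ.+ t) i))
                                        (ℚP.*-distribˡ-+ (Q' (i ℕ.+ t)) _ _)) s ⟩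
  horner (m ∸ i) (λ t → Q' (i ℕ.+ t) * binom (i ℕ.+ t) i + Q' (i ℕ.+ t) * binom (i ℕ.+ t) (suc i)) s
    ≡⟨ horner-+ (m ∸ i) _ _ s ⟩
  taylorShift m Q' s i + horner (m ∸ i) (λ t → Q' (i ℕ.+ t) * binom (i ℕ.+ t) (suc i)) s
    ≡⟨ cong (λ v → taylorShift m Q' s i + v) (horner-leading-0 (m ∸ i) _ s leading-0) ⟩
  taylorShift m Q' s i + s * horner (ℕ.pred (m ∸ i)) (λ t → Q' (i ℕ.+ suc t) * binom (i ℕ.+ suc t) (suc i)) s
    ≡⟨ cong (λ v → taylorShift m Q' s i + s * v) shift-index ⟩
  taylorShift m Q' s i + s * taylorShift m Q' s (suc i) ∎
  where
    Q' = tail Q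
    leading-0 : Q' (i ℕ.+ 0) * binom (i ℕ.+ 0) (suc i) ≡ 0ℚ
    leading-0 = trans (cong (λ c → Q' (i ℕ.+ 0) * ℕ→ℚ c)
                            (k>n⇒nCk≡0 (ℕP.≤-reflexive (cong suc (ℕP.+-identityʳ i)))))
                      (ℚP.*-zeroʳ (Q' (i ℕ.+ 0)))
    shift-index : horner (ℕ.pred (m ∸ i)) (λ t → Q' (i ℕ.+ suc t) * binom (i ℕ.+ suc t) (suc i)) s
                ≡ taylorShift m Q' s (suc i)
    shift-index = trans (horner-cong (ℕ.pred (m ∸ i)) (λ t → cong (λ j → Q' j * binom j (suc i)) (ℕP.+-suc i t)) s)
                        (cong (λ k → horner k (λ t → Q' (suc i ℕ.+ t) * binom (suc i ℕ.+ t) (suc i)) s)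
                              (ℕP.pred[m∸n]≡m∸[1+n] m i))

taylorShift-top : ∀ m Q s → taylorShift m Q s m ≡ 0ℚ
taylorShift-top m Q s = cong (λ k → horner k (λ t → Q (m ℕ.+ t) * binom (m ℕ.+ t) m) s) (ℕP.n∸n≡0 m)

taylorShift-last : ∀ n Q s → taylorShift (suc n) Q s n ≡ Q n
taylorShift-last n Q s rewrite ℕP.m+n∸n≡m 1 n | ℕP.+-identityʳ n | nCn≡1 n =
  solve 2 (λ q s → q :* con 1ℚ :+ s :* con 0ℚ := q) refl (Q n) s

horner-taylorShift : ∀ m Q s y → horner m (taylorShift m Q s) y ≡ horner m Q (s + y)
horner-taylorShift zero    Q s y = refl
horner-taylorShift (suc m) Q s y = begin
  taylorShift (suc m) Q s 0 + y * horner m (tail (taylorShift (suc m) Q s)) y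
    ≡⟨ cong₂ (λ u v → u + y * v) (taylorShift-zero m Q s) (horner-cong m (taylorShift-suc m Q s) y) ⟩
  (Q 0 + s * F₀) + y * horner m (λ i → taylorShift m Q' s i + s * taylorShift m Q' s (suc i)) y
    ≡⟨ cong (λ v → (Q 0 + s * F₀) + y * v) (trans (horner-+ m _ _ y) (cong (λ v → G + v) (horner-* m s _ y))) ⟩
  (Q 0 + s * F₀) + y * (G + s * H)
    ≡⟨ cong (λ v → (Q 0 + s * F₀) + y * (v + s * H)) G-unfold ⟩
  (Q 0 + s * F₀) + y * ((F₀ + y * H) + s * H)
    ≡⟨ solve 5 (λ q s y f h → (q :+ s :* f) :+ y :* ((f :+ y :* h) :+ s :* h) := q :+ (s :+ y) :* (f :+ y :* h))
         refl (Q 0) s y F₀ H ⟩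
  Q 0 + (s + y) * (F₀ + y * H)
    ≡⟨ cong (λ v → Q 0 + (s + y) * v) (trans (sym G-unfold) (horner-taylorShift m Q' s y)) ⟩
  Q 0 + (s + y) * horner m Q' (s + y) ∎
  where
    Q' = tail Q
    F₀ = taylorShift m Q' s 0
    G = horner m (taylorShift m Q' s) y
    H = horner m (tail (taylorShift m Q' s)) y
    G-unfold : G ≡ F₀ + y * H
    G-unfold = horner-unfold m (taylorShift m Q' s) y (taylorShift-top m Q' s)

-- The function p with its periodic coefficients frozen

sumFin-cong : ∀ n {f g : Fin n → ℚ} → (∀ i → f i ≡ g i) → sumFin n f ≡ sumFin n g
sumFin-cong zero    f≗g = refl
sumFin-cong (suc n) f≗g = cong₂ _+_ (f≗g Fin.zero) (sumFin-cong n (f≗g ∘ Fin.suc))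

sumFin-* : ∀ n (f g : Fin n → ℚ) x → sumFin n (λ i → f i * (x * g i)) ≡ x * sumFin n (λ i → f i * g i)
sumFin-* zero    f g x = sym (ℚP.*-zeroʳ x)
sumFin-* (suc n) f g x = begin
  f Fin.zero * (x * g Fin.zero) + sumFin n (λ i → f (Fin.suc i) * (x * g (Fin.suc i)))
    ≡⟨ cong (λ v → f Fin.zero * (x * g Fin.zero) + v) (sumFin-* n (f ∘ Fin.suc) (g ∘ Fin.suc) x) ⟩
  f Fin.zero * (x * g Fin.zero) + x * S
    ≡⟨ solve 4 (λ f x g s → f :* (x :* g) :+ x :* s := x :* (f :* g :+ s)) refl (f Fin.zero) x (g Fin.zero) S ⟩
  x * (f Fin.zero * g Fin.zero + S) ∎
  where S = sumFin n (λ i → f (Fin.suc i) * g (Fin.suc i))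

-- Indices beyond n are junk: every index j ≥ n yields pₙ.
frozenCoeffs : (n : ℕ) → ℚ → (Fin n → ℚ → ℚ) → ℚ → ℕ → ℚ
frozenCoeffs zero    pn ps r j       = pn
frozenCoeffs (suc n) pn ps r zero    = ps Fin.zero r
frozenCoeffs (suc n) pn ps r (suc j) = frozenCoeffs n pn (ps ∘ Fin.suc) r j

frozenCoeffs-toℕ : ∀ n pn ps r (i : Fin n) → frozenCoeffs n pn ps r (toℕ i) ≡ ps i r
frozenCoeffs-toℕ (suc n) pn ps r Fin.zero    = refl
frozenCoeffs-toℕ (suc n) pn ps r (Fin.suc i) = frozenCoeffs-toℕ n pn (ps ∘ Fin.suc) r i

frozenCoeffs-top : ∀ n pn ps r → frozenCoeffs n pn ps r n ≡ pn
frozenCoeffs-top zero    pn ps r = refl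
frozenCoeffs-top (suc n) pn ps r = frozenCoeffs-top n pn (ps ∘ Fin.suc) r

pFun-frozen : ∀ n pn (ps : Fin n → ℚ → ℚ) r x →
  pFun n pn (λ i _ → ps i r) x ≡ horner (suc n) (frozenCoeffs n pn ps r) x
pFun-frozen zero    pn ps r x = solve 2 (λ p x → p :* con 1ℚ :+ con 0ℚ := p :+ x :* con 0ℚ) refl pn x
pFun-frozen (suc n) pn ps r x = begin
  pn * (x * x ^ℚ n) + (ps Fin.zero r * 1ℚ + sumFin n (λ i → ps (Fin.suc i) r * (x * x ^ℚ toℕ i)))
    ≡⟨ cong (λ v → pn * (x * x ^ℚ n) + (ps Fin.zero r * 1ℚ + v))
            (sumFin-* n (λ i → ps (Fin.suc i) r) (λ i → x ^ℚ toℕ i) x) ⟩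
  pn * (x * x ^ℚ n) + (ps Fin.zero r * 1ℚ + x * S)
    ≡⟨ solve 5 (λ p x X q S → p :* (x :* X) :+ (q :* con 1ℚ :+ x :* S) := q :+ x :* (p :* X :+ S))
         refl pn x (x ^ℚ n) (ps Fin.zero r) S ⟩
  ps Fin.zero r + x * pFun n pn (λ i _ → ps (Fin.suc i) r) x
    ≡⟨ cong (λ v → ps Fin.zero r + x * v) (pFun-frozen n pn (ps ∘ Fin.suc) r x) ⟩
  horner (suc (suc n)) (frozenCoeffs (suc n) pn ps r) x ∎
  where S = sumFin n (λ i → ps (Fin.suc i) r * x ^ℚ toℕ i)

Periodic-iterate : ∀ {d f} → Periodic d f → ∀ k r → f (r + ℕ→ℚ k * d) ≡ f r
Periodic-iterate {d} {f} per zero    r = cong f (solve 2 (λ r d → r :+ con 0ℚ :* d := r) refl r d)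
Periodic-iterate {d} {f} per (suc k) r = begin
  f (r + ℕ→ℚ (suc k) * d)      ≡⟨ cong (λ c → f (r + c * d)) (ℕ→ℚ-+ 1 k) ⟩
  f (r + (1ℚ + ℕ→ℚ k) * d)     ≡⟨ cong f (solve 3 (λ r K d → r :+ (con 1ℚ :+ K) :* d := (r :+ K :* d) :+ d)
                                                refl r (ℕ→ℚ k) d) ⟩
  f ((r + ℕ→ℚ k * d) + d)      ≡⟨ per (r + ℕ→ℚ k * d) ⟩
  f (r + ℕ→ℚ k * d)            ≡⟨ Periodic-iterate per k r ⟩
  f r                          ∎

pFun-periodic : ∀ n pn ps {d} → (∀ i → Periodic d (ps i)) → ∀ k r →
  pFun n pn ps (r + ℕ→ℚ k * d) ≡ pFun n pn (λ i _ → ps i r) (r + ℕ→ℚ k * d)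
pFun-periodic n pn ps {d} periodic k r = cong (λ v → pn * (r + ℕ→ℚ k * d) ^ℚ n + v)
  (sumFin-cong n (λ i → cong (_* _) (Periodic-iterate (periodic i) k r)))

progression-injective : ∀ {d} → d ≢ 0ℚ → ∀ r → Injective _≡_ _≡_ (λ k → r + ℕ→ℚ k * d)
progression-injective {d} d≢0 r {i} {j} eq =
  ℕ→ℚ-injective (p-q≡0⇒p≡q _ _ (*-cancelˡ-≡0 d≢0 (begin
    d * (ℕ→ℚ i - ℕ→ℚ j)                     ≡⟨ solve 4 (λ d r I J → d :* (I :- J) := (r :+ I :* d) :- (r :+ J :* d))
                                                      refl d r (ℕ→ℚ i) (ℕ→ℚ j) ⟩
    (r + ℕ→ℚ i * d) - (r + ℕ→ℚ j * d)       ≡⟨ p≡q⇒p-q≡0 eq ⟩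
    0ℚ                                      ∎)))

-- Recovering the coefficients pᵢ on the interval

module Recovery
  (n : ℕ) (pn : ℚ) (ps : Fin n → ℚ → ℚ) {d : ℚ} (d≢0 : d ≢ 0ℚ) (periodic : ∀ i → Periodic d (ps i))
  {r₁ r₂ : ℚ} (c : ℕ → ℚ) (p-const : ∀ k r → InOpen r₁ r₂ r → pFun n pn ps (r + ℕ→ℚ k * d) ≡ c k)
  {r₀ : ℚ} (r₀∈ : InOpen r₁ r₂ r₀)
  where

  P : ℚ → ℕ → ℚ
  P = frozenCoeffs n pn ps

  horner-P : ∀ {r} → InOpen r₁ r₂ r → ∀ k → horner (suc n) (P r) (r + ℕ→ℚ k * d) ≡ c k
  horner-P {r} r∈ k = begin
    horner (suc n) (P r) x          ≡⟨ pFun-frozen n pn ps r x ⟨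
    pFun n pn (λ i _ → ps i r) x    ≡⟨ pFun-periodic n pn ps periodic k r ⟨
    pFun n pn ps x                  ≡⟨ p-const k r r∈ ⟩
    c k                             ∎
    where x = r + ℕ→ℚ k * d

  B : ℕ → ℚ
  B = taylorShift (suc n) (P r₀) r₀

  horner-B : ∀ k → horner (suc n) B (ℕ→ℚ k * d) ≡ c k
  horner-B k = trans (horner-taylorShift (suc n) (P r₀) r₀ (ℕ→ℚ k * d)) (horner-P r₀∈ k)

  P≡taylorShift-B : ∀ {r} → InOpen r₁ r₂ r → ∀ {j} → j ℕ.≤ n → P r j ≡ taylorShift (suc n) B (- r) j
  P≡taylorShift-B {r} r∈ j≤n =
    horner-agree⇒coeff-agree (suc n) (P r) (taylorShift (suc n) B (- r)) (progression-injective d≢0 r) agree (s≤s j≤n)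
    where
      agree : ∀ k → horner (suc n) (P r) (r + ℕ→ℚ k * d) ≡ horner (suc n) (taylorShift (suc n) B (- r)) (r + ℕ→ℚ k * d)
      agree k = begin
        horner (suc n) (P r) x                          ≡⟨ horner-P r∈ k ⟩
        c k                                             ≡⟨ horner-B k ⟨
        horner (suc n) B (ℕ→ℚ k * d)                    ≡⟨ cong (horner (suc n) B)
                                                             (solve 3 (λ r K d → K :* d := :- r :+ (r :+ K :* d)) refl r (ℕ→ℚ k) d) ⟩
        horner (suc n) B (- r + x)                      ≡⟨ horner-taylorShift (suc n) B (- r) x ⟨
        horner (suc n) (taylorShift (suc n) B (- r)) x  ∎
        where x = r + ℕ→ℚ k * d

  B-top : B n ≡ pn
  B-top = begin
    B n                                   ≡⟨ taylorShift-last n B (- r₀) ⟨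
    taylorShift (suc n) B (- r₀) n        ≡⟨ P≡taylorShift-B r₀∈ ℕP.≤-refl ⟨
    P r₀ n                                ≡⟨ frozenCoeffs-top n pn ps r₀ ⟩
    pn                                    ∎

  coeff : Fin n → ℕ → ℚ
  coeff i t = B (toℕ i ℕ.+ t) * binom (toℕ i ℕ.+ t) (toℕ i) * (- 1ℚ) ^ℚ t

  ps≡horner-coeff : ∀ i {r} → InOpen r₁ r₂ r → ps i r ≡ horner (suc (n ∸ toℕ i)) (coeff i) r
  ps≡horner-coeff i {r} r∈ = begin
    ps i r                                     ≡⟨ frozenCoeffs-toℕ n pn ps r i ⟨
    P r (toℕ i)                                ≡⟨ P≡taylorShift-B r∈ (FinP.toℕ≤n i) ⟩
    horner (suc n ∸ toℕ i) b (- r)             ≡⟨ cong (λ m → horner m b (- r)) (ℕP.+-∸-assoc 1 (FinP.toℕ≤n i)) ⟩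
    horner (suc (n ∸ toℕ i)) b (- r)           ≡⟨ horner-at-neg (suc (n ∸ toℕ i)) b r ⟩
    horner (suc (n ∸ toℕ i)) (coeff i) r       ∎
    where b = λ t → B (toℕ i ℕ.+ t) * binom (toℕ i ℕ.+ t) (toℕ i)

  coeff-top : ∀ i → coeff i (n ∸ toℕ i) ≡ pn * binom n (toℕ i) * (- 1ℚ) ^ℚ (n ∸ toℕ i)
  coeff-top i = begin
    coeff i (n ∸ toℕ i)                          ≡⟨ cong (λ m → B m * binom m (toℕ i) * (- 1ℚ) ^ℚ (n ∸ toℕ i))
                                                         (ℕP.m+[n∸m]≡n (FinP.toℕ≤n i)) ⟩
    B n * binom n (toℕ i) * (- 1ℚ) ^ℚ (n ∸ toℕ i)  ≡⟨ cong (λ b → b * binom n (toℕ i) * (- 1ℚ) ^ℚ (n ∸ toℕ i)) B-top ⟩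
    pn * binom n (toℕ i) * (- 1ℚ) ^ℚ (n ∸ toℕ i)   ∎

  coeff-top-≢0 : pn ≢ 0ℚ → ∀ i → coeff i (n ∸ toℕ i) ≢ 0ℚ
  coeff-top-≢0 pn≢0 i = *-≢0 (*-≢0 pn≢0 (pos⇒≢0 (binom-pos (FinP.toℕ≤n i)))) (^ℚ-≢0 -1≢0 (n ∸ toℕ i))
                        ∘ trans (sym (coeff-top i))

  coeff-top-neg : Positive pn → ∀ i → suc (toℕ i) ≡ n → coeff i (n ∸ toℕ i) < 0ℚ
  coeff-top-neg pn>0 i i+1≡n = subst (_< 0ℚ) (sym (begin
    coeff i (n ∸ toℕ i)                ≡⟨ coeff-top i ⟩
    pn * C * (- 1ℚ) ^ℚ (n ∸ toℕ i)     ≡⟨ cong (λ m → pn * C * (- 1ℚ) ^ℚ m) n∸i≡1 ⟩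
    pn * C * (- 1ℚ * 1ℚ)               ≡⟨ solve 2 (λ p b → p :* b :* (:- con 1ℚ :* con 1ℚ) := :- (p :* b)) refl pn C ⟩
    - (pn * C)                         ∎))
    (ℚP.neg-antimono-< (ℚP.positive⁻¹ (pn * C)))
    where
      C = binom n (toℕ i)
      n∸i≡1 : n ∸ toℕ i ≡ 1
      n∸i≡1 = trans (cong (_∸ toℕ i) (sym i+1≡n)) (ℕP.m+n∸n≡m 1 (toℕ i))
      instance
        _ = pn>0
        _ = binom-pos {n} {toℕ i} (FinP.toℕ≤n i)
        _ = ℚP.pos*pos⇒pos pn C

lemma2p6 : (n : ℕ) → .{{_ : NonZero n}} → (d : ℚ) → Positive d →
    (pn : ℚ) → pn ≢ 0ℚ → (ps : Fin n → ℚ → ℚ) → (∀ i → Periodic d (ps i)) →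
    (r₁ r₂ : ℚ) → r₁ < r₂ →
    (Σ (ℕ → ℚ) λ c → ∀ (k : ℕ) (r : ℚ) → InOpen r₁ r₂ r → pFun n pn ps (r + ℕ→ℚ k * d) ≡ c k) →
    Σ ((i : Fin n) → Vec ℚ (suc (n ∸ toℕ i))) λ a →
      (∀ (i : Fin n) → PolyOfDegreeOn r₁ r₂ (n ∸ toℕ i) (ps i) (a i)) ×
      (Positive pn → ∀ (i : Fin n) → suc (toℕ i) ≡ n → last (a i) < 0ℚ)
lemma2p6 n d d>0 pn pn≢0 ps periodic r₁ r₂ r₁<r₂ (c , p-const) = a , polynomial , leading-negative
  where
    open Recovery n pn ps (pos⇒≢0 d>0) periodic c p-const (proj₂ (ℚP.<-dense r₁<r₂))

    a : (i : Fin n) → Vec ℚ (suc (n ∸ toℕ i))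
    a i = coeffVec (suc (n ∸ toℕ i)) (coeff i)

    polynomial : ∀ i → PolyOfDegreeOn r₁ r₂ (n ∸ toℕ i) (ps i) (a i)
    polynomial i = coeff-top-≢0 pn≢0 i ∘ trans (sym (last-coeffVec (n ∸ toℕ i) (coeff i)))
                 , λ r r∈ → trans (ps≡horner-coeff i r∈) (sym (evalPoly-coeffVec (suc (n ∸ toℕ i)) (coeff i) r))

    leading-negative : Positive pn → ∀ i → suc (toℕ i) ≡ n → last (a i) < 0ℚ
    leading-negative pn>0 i i+1≡n =
      subst (_< 0ℚ) (sym (last-coeffVec (n ∸ toℕ i) (coeff i))) (coeff-top-neg pn>0 i i+1≡n)
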